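{- In COT, every index is greater than every element of the class it indexes: for every class $X$ for which $\iota(X)$ is defined and every ordinal $y$, if $y\,\varepsilon\,X$ then $y<\iota(X)$.
   Context: The theory COT is formulated in two-sorted first-order logic with equality. Lower-case variables range over the first sort ("ordinals"), upper-case variables over the second sort ("classes"). The primitives are a relation $x\,\varepsilon\,X$ (ordinal to class), a binary relation $\prec$ on classes, and a partial unary function $\iota$ from classes to ordinals. Write $X\equiv Y$ for $\forall z(z\,\varepsilon\,X\leftrightarrow z\,\varepsilon\,Y)$. An expression $\psi(\{x\mid\phi\})$ abbreviates $\forall X[\forall x(x\,\varepsilon\,X\leftrightarrow\phi)\to\psi(X)]$; in particular $\{x\}$ stands for any class whose only member is $x$. Axioms of COT: (1) Comprehension: $\exists X\forall x(x\,\varepsilon\,X\leftrightarrow\phi)$ for every formula $\phi$ with $X$ not free. (2) $\prec$ is transitive; $X\not\equiv Y\leftrightarrow(X\prec Y\lor Y\prec X)$; for every formula $\phi$, $\phi(X)\to\exists M(\phi(M)\land\forall Y(\phi(Y)\to\neg\,Y\prec M))$. Define $x<y$ iff $\{x\}\prec\{y\}$; $\lim X$ = the $<$-least $l$ with $x<l$ for all $x\,\varepsilon\,X$ (when it exists); $\mathrm{bnd}(X)$ iff $\lim X$ exists. (3) If $\lim X\le y\,\varepsilon\,Y$ then $X\prec Y$. (4) For every $X$ with $\mathrm{bnd}(X)$, $\iota(X)$ is defined and $\iota(X)=\lim\{\iota(Y)\mid Y\prec X\}$. (5) $\exists l\,(\exists k\,(k<l)\land\forall x<l\,\exists y\,(x<y<l))$.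 (6) If $\mathrm{bnd}(X)$ and there is a class-given bijection between the members of $X$ and those of $Y$, then $\mathrm{bnd}(Y)$.
   Formalization: Axiom (4) also makes ι(X) defined only when bnd(X), so ι is defined exactly on the bounded classes; the class-given bijection in (6) is one given by a formula with parameters. Apart from conventions, each condition added here is assumed in the paper as well or is needed for the statement above to hold. -}

module Defs where

open import Data.Nat using (ℕ; zero; suc)
open import Data.Product using (Σ; _×_; _,_)
open import Data.Sum using (_⊎_)
open import Data.Empty using (⊥)
open import Data.Maybe using (Maybe; just)
open import Relation.Nullary using (¬_)
open import Relation.Binary.PropositionalEquality using (_≡_)

Iff : Set → Set → Set
Iff A B = (A → B) × (B → A)

-- Environment extension (de Bruijn: index 0 is the newest variable).
_∷ₑ_ : {A : Set} → A → (ℕ → A) → ℕ → A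
(a ∷ₑ ρ) zero    = a
(a ∷ₑ ρ) (suc n) = ρ n

-- Signature of COT: two sorts, ε, ≺, and a partial function ι
-- (partiality rendered with Maybe: ι X ≡ just x  means  ι(X) = x).

record Sig : Set₁ where
  field
    Ord   : Set
    Class : Set
    _ε_   : Ord → Class → Set
    _≺_   : Class → Class → Set
    ι     : Class → Maybe Ord

-- Variables are de Bruijn indices: ordinal variables and class variables
-- are counted separately.  ι(X) = x is the atomic formula  ι≐ X x.

data Fm : Set where
  _ε'_  : ℕ → ℕ → Fm          -- x_i ε X_j
  _≺'_  : ℕ → ℕ → Fm
  _≐o_  : ℕ → ℕ → Fm
  _≐c_  : ℕ → ℕ → Fm
  ι≐    : ℕ → ℕ → Fm          -- ι(X_i) = x_j
  ⊥'    : Fm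
  _∧'_  : Fm → Fm → Fm
  _∨'_  : Fm → Fm → Fm
  _⇒'_  : Fm → Fm → Fm
  ∀o    : Fm → Fm
  ∃o    : Fm → Fm
  ∀c    : Fm → Fm
  ∃c    : Fm → Fm

module _ (S : Sig) where
  open Sig S

  Sat : Fm → (ℕ → Ord) → (ℕ → Class) → Set
  Sat (i ε' j)  ρ σ = ρ i ε σ j
  Sat (i ≺' j)  ρ σ = σ i ≺ σ j
  Sat (i ≐o j)  ρ σ = ρ i ≡ ρ j
  Sat (i ≐c j)  ρ σ = σ i ≡ σ j
  Sat (ι≐ i j)  ρ σ = ι (σ i) ≡ just (ρ j)
  Sat ⊥'        ρ σ = ⊥
  Sat (φ ∧' ψ)  ρ σ = Sat φ ρ σ × Sat ψ ρ σ
  Sat (φ ∨' ψ)  ρ σ = Sat φ ρ σ ⊎ Sat ψ ρ σ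
  Sat (φ ⇒' ψ)  ρ σ = Sat φ ρ σ → Sat ψ ρ σ
  Sat (∀o φ)    ρ σ = (x : Ord) → Sat φ (x ∷ₑ ρ) σ
  Sat (∃o φ)    ρ σ = Σ Ord λ x → Sat φ (x ∷ₑ ρ) σ
  Sat (∀c φ)    ρ σ = (X : Class) → Sat φ ρ (X ∷ₑ σ)
  Sat (∃c φ)    ρ σ = Σ Class λ X → Sat φ ρ (X ∷ₑ σ)

  _≡ₓ_ : Class → Class → Set
  X ≡ₓ Y = (z : Ord) → Iff (z ε X) (z ε Y)

  IsSingleton : Class → Ord → Set
  IsSingleton X x = (z : Ord) → Iff (z ε X) (z ≡ x)

  -- x < y  iff  {x} ≺ {y}   (abbreviation read universally, as in the paper)
  _<_ : Ord → Ord → Set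
  x < y = (X Y : Class) → IsSingleton X x → IsSingleton Y y → X ≺ Y

  _≤_ : Ord → Ord → Set
  x ≤ y = (x < y) ⊎ (x ≡ y)

  IsLim : Class → Ord → Set
  IsLim X l = ((x : Ord) → x ε X → x < l)
            × ((l' : Ord) → ((x : Ord) → x ε X → x < l') → l ≤ l')

  bnd : Class → Set
  bnd X = Σ Ord λ l → IsLim X l

  IsIotaImage : Class → Class → Set
  IsIotaImage X Z = (z : Ord) → Iff (z ε Z) (Σ Class λ Y → (Y ≺ X) × (ι Y ≡ just z))

  -- A definable (formula with parameters) bijection between the members of X
  -- and those of Y; R x y is  φ(x,y)  with x as ordinal variable 0, y as 1.
  DefBij : Fm → (ℕ → Ord) → (ℕ → Class) → Class → Class → Set
  DefBij φ ρ σ X Y =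
      ((x : Ord) → x ε X → Σ Ord λ y → (y ε Y) × R x y
                     × ((y' : Ord) → y' ε Y → R x y' → y' ≡ y))
    × ((y : Ord) → y ε Y → Σ Ord λ x → (x ε X) × R x y
                     × ((x' : Ord) → x' ε X → R x' y → x' ≡ x))
    where
      R : Ord → Ord → Set
      R x y = Sat φ (x ∷ₑ (y ∷ₑ ρ)) σ

  record IsCOT : Set where
    field
      -- (1) Comprehension scheme (formula φ, free ordinal variable 0, parameters)
      comprehension : (φ : Fm) (ρ : ℕ → Ord) (σ : ℕ → Class) →
        Σ Class λ X → (x : Ord) → Iff (x ε X) (Sat φ (x ∷ₑ ρ) σ)
      ≺-trans : (X Y Z : Class) → X ≺ Y → Y ≺ Z → X ≺ Z
      ≺-total : (X Y : Class) → Iff (¬ (X ≡ₓ Y)) ((X ≺ Y) ⊎ (Y ≺ X))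
      ≺-min   : (φ : Fm) (ρ : ℕ → Ord) (σ : ℕ → Class) (X : Class) →
        Sat φ ρ (X ∷ₑ σ) →
        Σ Class λ M → Sat φ ρ (M ∷ₑ σ)
                    × ((Y : Class) → Sat φ ρ (Y ∷ₑ σ) → ¬ (Y ≺ M))
      -- (3)
      lim-≺ : (X Y : Class) (l y : Ord) → IsLim X l → l ≤ y → y ε Y → X ≺ Y
      -- (4) ι(X) is defined for bounded X and equals lim{ι(Y) | Y ≺ X}
      ι-def : (X : Class) → bnd X →
        Σ Ord λ i → (ι X ≡ just i)
                  × ((Z : Class) → IsIotaImage X Z → IsLim Z i)
      ι-dom : (X : Class) (i : Ord) → ι X ≡ just i → bnd X
      -- (5) a limit ordinal exists
      limit : Σ Ord λ l → (Σ Ord λ k → k < l)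
                        × ((x : Ord) → x < l → Σ Ord λ y → (x < y) × (y < l))
      bnd-bij : (φ : Fm) (ρ : ℕ → Ord) (σ : ℕ → Class) (X Y : Class) →
        bnd X → DefBij φ ρ σ X Y → bnd Y

-- Classical metatheory (the paper works in classical logic).
LEM : Set₁
LEM = (P : Set) → P ⊎ ¬ P

-- Assume ι(X) = i and y ε X but not y < i, so i ≤ y.  The class Z = {ι(Y) | Y ≺ X}
-- has limit i by axiom (4), and i ≤ y ε X gives Z ≺ X by axiom (3).  Hence Z is
-- bounded, and its index ι(Z), being the index of a class below X, lies in Z.
-- So some class contains its own index; a ≺-minimal such class M contradicts the
-- same argument applied to M with y = ι(M), which produces one strictly below M.
module Submission where

open import Defs
open import Data.Maybe using (just)
open import Data.Maybe.Properties using (just-injective)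
open import Relation.Binary.PropositionalEquality using (_≡_; refl; sym; trans; subst)
open import Data.Product using (Σ; _×_; _,_; proj₁; proj₂)
open import Data.Sum using (inj₁; inj₂)
open import Data.Empty using (⊥-elim)
open import Relation.Nullary using (¬_)

module COT (S : Sig) (cot : IsCOT S) where
  open Sig S
  open IsCOT cot

  ≡ₓ-sym : {X Y : Class} → _≡ₓ_ S X Y → _≡ₓ_ S Y X
  ≡ₓ-sym e z = proj₂ (e z) , proj₁ (e z)

  ≡ₓ-trans : {X Y Z : Class} → _≡ₓ_ S X Y → _≡ₓ_ S Y Z → _≡ₓ_ S X Z
  ≡ₓ-trans e f z = (λ p → proj₁ (f z) (proj₁ (e z) p)) , (λ p → proj₂ (e z) (proj₂ (f z) p))

  ≺⇒≢ₓ : {X Y : Class} → X ≺ Y → ¬ (_≡ₓ_ S X Y)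
  ≺⇒≢ₓ {X} {Y} p = proj₂ (≺-total X Y) (inj₁ p)

  ≺-respˡ-≡ₓ : {X X' Y : Class} → _≡ₓ_ S X X' → X ≺ Y → X' ≺ Y
  ≺-respˡ-≡ₓ {X} {X'} {Y} e p with proj₁ (≺-total X' Y) (λ e' → ≺⇒≢ₓ p (≡ₓ-trans e e'))
  ... | inj₁ q = q
  ... | inj₂ q = ⊥-elim (≺⇒≢ₓ (≺-trans X Y X' p q) e)

  ≺-respʳ-≡ₓ : {X Y Y' : Class} → _≡ₓ_ S Y Y' → X ≺ Y → X ≺ Y'
  ≺-respʳ-≡ₓ {X} {Y} {Y'} e p with proj₁ (≺-total X Y') (λ e' → ≺⇒≢ₓ p (≡ₓ-trans e' (≡ₓ-sym e)))
  ... | inj₁ q = q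
  ... | inj₂ q = ⊥-elim (≺⇒≢ₓ (≺-trans Y' X Y q p) (≡ₓ-sym e))

  singleton-≡ₓ : {A A' : Class} {x : Ord} → IsSingleton S A x → IsSingleton S A' x → _≡ₓ_ S A A'
  singleton-≡ₓ sA sA' z = (λ p → proj₂ (sA' z) (proj₁ (sA z) p)) , (λ p → proj₂ (sA z) (proj₁ (sA' z) p))

  ≮⇒≥ : LEM → {x y : Ord} → ¬ (_<_ S x y) → _≤_ S y x
  ≮⇒≥ lem {x} {y} x≮y with lem (y ≡ x)
  ... | inj₁ y≡x = inj₂ y≡x
  ... | inj₂ y≢x = inj₁ y<x
    where
    -- {y} and {x} are not coextensive, so ≺ compares them, and {x} ≺ {y} would give x < y.
    y<x : _<_ S y x
    y<x B A sB sA with proj₁ (≺-total B A) (λ e → y≢x (proj₁ (sA y) (proj₁ (e y) (proj₂ (sB y) refl))))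
    ... | inj₁ q = q
    ... | inj₂ q = ⊥-elim (x≮y (λ A' B' sA' sB' →
          ≺-respʳ-≡ₓ (singleton-≡ₓ sB sB') (≺-respˡ-≡ₓ (singleton-≡ₓ sA sA') q)))

  iotaImage : (X : Class) → Σ Class (IsIotaImage S X)
  -- The ordinal environment is irrelevant; axiom (5) merely supplies some ordinal to fill it.
  iotaImage X with comprehension (∃c ((0 ≺' 1) ∧' ι≐ 0 0)) (λ _ → proj₁ limit) (λ _ → X)
  ... | Z , def = Z , λ z → proj₁ (def z) , proj₂ (def z)

  ι-isLim : {X Z : Class} {i : Ord} → ι X ≡ just i → IsIotaImage S X Z → IsLim S Z i
  ι-isLim {X} {Z} eq img with ι-def X (ι-dom X _ eq)
  ... | _ , eq' , lim = subst (IsLim S Z) (just-injective (trans (sym eq') eq)) (lim Z img)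

  ContainsOwnIndex : Class → Set
  ContainsOwnIndex Z = Σ Ord λ j → (ι Z ≡ just j) × (j ε Z)

  below-containsOwnIndex : {X : Class} {i y : Ord} → ι X ≡ just i → _≤_ S i y → y ε X →
    Σ Class λ Z → (Z ≺ X) × ContainsOwnIndex Z
  below-containsOwnIndex {X} {i} {y} eq i≤y yX = Z , Z≺X , j , ιZ≡j , proj₂ (img j) (Z , Z≺X , ιZ≡j)
    where
    Z : Class
    Z = proj₁ (iotaImage X)
    img : IsIotaImage S X Z
    img = proj₂ (iotaImage X)
    limZ : IsLim S Z i
    limZ = ι-isLim eq img
    Z≺X : Z ≺ X
    Z≺X = lim-≺ Z X i y limZ i≤y yX
    j : Ord
    j = proj₁ (ι-def Z (i , limZ))
    ιZ≡j : ι Z ≡ just j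
    ιZ≡j = proj₁ (proj₂ (ι-def Z (i , limZ)))

  ¬containsOwnIndex : (X : Class) → ¬ ContainsOwnIndex X
  ¬containsOwnIndex X (k , eq , kX)
    with ≺-min (∃o ((0 ε' 0) ∧' ι≐ 0 0)) (λ _ → k) (λ _ → X) X (k , kX , eq)
  ... | M , (m , mM , ιM≡m) , minimal with below-containsOwnIndex ιM≡m (inj₂ refl) mM
  ... | Z , Z≺M , j , ιZ≡j , jZ = minimal Z (j , jZ , ιZ≡j) Z≺M

mainTheorem10 : LEM → (S : Sig) → IsCOT S →
    (X : Sig.Class S) (i y : Sig.Ord S) → Sig.ι S X ≡ just i →
    Sig._ε_ S y X → _<_ S y i
mainTheorem10 lem S cot X i y eq yX with lem (_<_ S y i)
... | inj₁ y<i = y<i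
... | inj₂ y≮i = ⊥-elim (¬containsOwnIndex _ (proj₂ (proj₂ (below-containsOwnIndex eq i≤y yX))))
  where
  open COT S cot
  i≤y : _≤_ S i y
  i≤y = ≮⇒≥ lem y≮i
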